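{- Let $G$ be a graph on $n$ vertices. Then $n-\gamma(G)\le \operatorname{VCIR}(G)$, and this bound is sharp (it holds with equality for some graph). Furthermore, $\operatorname{VCIR}(G)=n-1$ if and only if $\gamma(G)=1$.
   Context: Graphs are finite, simple, undirected, with nonempty vertex set. $\gamma(G)$ is the domination number. For $S\subseteq V(G)$ and $u\in S$, an edge $e$ of $G$ is a private edge of $u$ if $S\cap e=\{u\}$; $S$ is a VCIr-set if every element of $S$ has a private edge. $\operatorname{VCIR}(G)$ is the maximum cardinality of a VCIr-set of $G$. -}

module Defs where

open import Data.Nat using (ℕ; suc; _≤_)
open import Data.Bool using (Bool; true; false)
open import Data.Fin using (Fin)
open import Data.Fin.Subset using (Subset; _∈_; _∉_; ∣_∣)
open import Data.Product using (Σ; _×_; ∃-syntax)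
open import Data.Sum using (_⊎_)
open import Relation.Binary.PropositionalEquality using (_≡_)

record Graph (n : ℕ) : Set where
  field
    adj    : Fin n → Fin n → Bool
    sym    : ∀ u v → adj u v ≡ adj v u
    irrefl : ∀ u → adj u u ≡ false
open Graph public

IsDominating : ∀ {n} → Graph n → Subset n → Set
IsDominating G S = ∀ v → v ∈ S ⊎ (∃[ u ] (u ∈ S × adj G u v ≡ true))

IsDominationNumber : ∀ {n} → Graph n → ℕ → Set
IsDominationNumber G k =
  (∃[ S ] (IsDominating G S × ∣ S ∣ ≡ k)) × (∀ S → IsDominating G S → k ≤ ∣ S ∣)

-- The edge {u,v} (adj u v) is a private edge of u ∈ S iff S ∩ {u,v} = {u}, i.e. v ∉ S.
HasPrivateEdge : ∀ {n} → Graph n → Subset n → Fin n → Set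
HasPrivateEdge G S u = ∃[ v ] (adj G u v ≡ true × v ∉ S)

IsVCIrSet : ∀ {n} → Graph n → Subset n → Set
IsVCIrSet G S = ∀ u → u ∈ S → HasPrivateEdge G S u

IsVCIR : ∀ {n} → Graph n → ℕ → Set
IsVCIR G k =
  (∃[ S ] (IsVCIrSet G S × ∣ S ∣ ≡ k)) × (∀ S → IsVCIrSet G S → ∣ S ∣ ≤ k)

-- Complementation exchanges dominating sets and VCIr-sets: if D dominates G,
-- every vertex outside D has an edge into D, which is a private edge of it
-- with respect to V ∖ D; conversely a vertex of a VCIr-set S is dominated by
-- the far end of its private edge, which lies outside S. Hence
-- VCIR(G) = n − γ(G) for every graph: the bound is always an equality, and
-- as γ(G) ≤ n, VCIR(G) = n − 1 exactly when γ(G) = 1.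
module Submission where

open import Defs hiding (sym)
open import Data.Nat using (suc; _≤_; _∸_; s≤s; z≤n)
open import Data.Nat.Properties
  using (≤-antisym; ≤-reflexive; m<n⇒0<n; ∸-monoʳ-≤; m∸[m∸n]≡n; ∸-cancelˡ-≡)
open import Data.Product using (_×_; ∃-syntax; _,_)
open import Data.Sum using (inj₁; inj₂)
open import Data.Bool using (false)
open import Data.Fin using (zero)
open import Data.Fin.Subset using (∁; ⊤; ∣_∣)
open import Data.Fin.Subset.Properties
  using (_∈?_; x∈∁p⇒x∉p; x∉p⇒x∈∁p; ∣∁p∣≡n∸∣p∣; ∣p∣≤n; ∈⊤; x∈p⇒∣p-x∣<∣p∣)
open import Relation.Binary.PropositionalEquality using (_≡_; refl; sym; trans; subst; cong)
open import Relation.Nullary using (yes; no)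
open import Data.Empty using (⊥-elim)

module _ {n} (G : Graph n) where

  ∁-dominating⇒VCIr : ∀ D → IsDominating G D → IsVCIrSet G (∁ D)
  ∁-dominating⇒VCIr D dom u u∈∁D with dom u
  ... | inj₁ u∈D = ⊥-elim (x∈∁p⇒x∉p u∈∁D u∈D)
  ... | inj₂ (v , v∈D , vu) = v , trans (Graph.sym G u v) vu , λ v∈∁D → x∈∁p⇒x∉p v∈∁D v∈D

  ∁-VCIr⇒dominating : ∀ S → IsVCIrSet G S → IsDominating G (∁ S)
  ∁-VCIr⇒dominating S vc v with v ∈? S
  ... | no v∉S = inj₁ (x∉p⇒x∈∁p v∉S)
  ... | yes v∈S with vc v v∈S
  ... | w , vw , w∉S = inj₂ (w , x∉p⇒x∈∁p w∉S , trans (Graph.sym G w v) vw)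

  VCIr-size-bound : ∀ {g} S → IsDominationNumber G g → IsVCIrSet G S → ∣ S ∣ ≤ n ∸ g
  VCIr-size-bound {g} S (_ , minimal) vc = begin
    ∣ S ∣             ≡⟨ sym (m∸[m∸n]≡n (∣p∣≤n S)) ⟩
    n ∸ (n ∸ ∣ S ∣)   ≤⟨ ∸-monoʳ-≤ n g≤n∸∣S∣ ⟩
    n ∸ g             ∎
    where
    open Data.Nat.Properties.≤-Reasoning
    g≤n∸∣S∣ : g ≤ n ∸ ∣ S ∣
    g≤n∸∣S∣ = subst (g ≤_) (∣∁p∣≡n∸∣p∣ S) (minimal (∁ S) (∁-VCIr⇒dominating S vc))

  domination-number⇒VCIR : ∀ {g} → IsDominationNumber G g → IsVCIR G (n ∸ g)
  domination-number⇒VCIR γ@((D , dom , refl) , _) =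
    (∁ D , ∁-dominating⇒VCIr D dom , ∣∁p∣≡n∸∣p∣ D) , λ S vc → VCIr-size-bound S γ vc

  VCIR-unique : ∀ {r s} → IsVCIR G r → IsVCIR G s → r ≡ s
  VCIR-unique ((R , vcR , refl) , maxR) ((S , vcS , refl) , maxS) =
    ≤-antisym (maxS R vcR) (maxR S vcS)

  VCIR≡n∸domination-number : ∀ {g r} → IsDominationNumber G g → IsVCIR G r → r ≡ n ∸ g
  VCIR≡n∸domination-number γ vcir = VCIR-unique vcir (domination-number⇒VCIR γ)

  domination-number≤n : ∀ {g} → IsDominationNumber G g → g ≤ n
  domination-number≤n ((D , _ , refl) , _) = ∣p∣≤n D

dominating-nonempty : ∀ {m} (G : Graph (suc m)) D → IsDominating G D → 1 ≤ ∣ D ∣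
dominating-nonempty G D dom with dom zero
... | inj₁ zero∈D        = m<n⇒0<n (x∈p⇒∣p-x∣<∣p∣ zero∈D)
... | inj₂ (u , u∈D , _) = m<n⇒0<n (x∈p⇒∣p-x∣<∣p∣ u∈D)

K₁ : Graph 1
K₁ = record { adj = λ _ _ → false ; sym = λ _ _ → refl ; irrefl = λ _ → refl }

K₁-domination-number : IsDominationNumber K₁ 1
K₁-domination-number = (⊤ , (λ _ → inj₁ ∈⊤) , refl) , dominating-nonempty K₁

proposition3p58 :
    (∀ m (G : Graph (suc m)) g r → IsDominationNumber G g → IsVCIR G r →
      (suc m ∸ g ≤ r)
      × ((r ≡ suc m ∸ 1 → g ≡ 1) × (g ≡ 1 → r ≡ suc m ∸ 1)))
    × (∃[ m ] ∃[ G ] ∃[ g ] ∃[ r ]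
        (IsDominationNumber {suc m} G g × IsVCIR G r × suc m ∸ g ≡ r))
proposition3p58 = bounds , sharp
  where
  bounds : ∀ m (G : Graph (suc m)) g r → IsDominationNumber G g → IsVCIR G r →
    (suc m ∸ g ≤ r) × ((r ≡ suc m ∸ 1 → g ≡ 1) × (g ≡ 1 → r ≡ suc m ∸ 1))
  bounds m G g r γ vcir =
      ≤-reflexive (sym r≡n∸g)
    , (λ r≡n∸1 → ∸-cancelˡ-≡ (domination-number≤n G γ) (s≤s z≤n)
                   (trans (sym r≡n∸g) r≡n∸1))
    , (λ g≡1 → trans r≡n∸g (cong (suc m ∸_) g≡1))
    where
    r≡n∸g : r ≡ suc m ∸ g
    r≡n∸g = VCIR≡n∸domination-number G γ vcir
  sharp : ∃[ m ] ∃[ G ] ∃[ g ] ∃[ r ]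
    (IsDominationNumber {suc m} G g × IsVCIR G r × suc m ∸ g ≡ r)
  sharp = 0 , K₁ , 1 , 0 , K₁-domination-number , domination-number⇒VCIR K₁ K₁-domination-number , refl
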